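{- Let $\mathcal{L}$ be a finite semidistributive lattice. Then $\mathcal{L}$ is atomic if and only if $\mathcal{L}\cong\mathrm{Bool}(n)$ for some $n\in\mathbb{N}$.
   Context: A finite lattice is join-semidistributive if for all $x,y,z$ with $x\vee y=x\vee z$ one has $x\vee(y\wedge z)=x\vee y$; meet-semidistributive is the dual condition; semidistributive means both. A lattice is atomic if every element is a join of atoms (elements covering $\hat0$). $\mathrm{Bool}(n)=(\wp(\{1,\dots,n\}),\subseteq)$ is the Boolean lattice. -}

module Defs where

open import Level using (Level; _⊔_)
open import Data.Nat using (ℕ)
open import Data.Fin using (Fin)
open import Data.Fin.Subset using (Subset; _⊆_)
open import Data.List using (List; foldr)
open import Data.List.Relation.Unary.All using (All)
open import Data.Product using (Σ; ∃; _×_; _,_)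
open import Data.Sum using (_⊎_)
open import Relation.Nullary using (¬_)
open import Relation.Binary.PropositionalEquality using (_≡_)
open import Relation.Binary.Lattice.Bundles using (BoundedLattice)

module _ {c ℓ₁ ℓ₂ : Level} (L : BoundedLattice c ℓ₁ ℓ₂) where
  open BoundedLattice L

  IsFinite : Set (c ⊔ ℓ₁)
  IsFinite = Σ ℕ λ n → Σ (Fin n → Carrier) λ e → ∀ x → ∃ λ i → e i ≈ x

  JoinSemidistributive : Set (c ⊔ ℓ₁)
  JoinSemidistributive = ∀ x y z → (x ∨ y) ≈ (x ∨ z) → (x ∨ (y ∧ z)) ≈ (x ∨ y)

  MeetSemidistributive : Set (c ⊔ ℓ₁)
  MeetSemidistributive = ∀ x y z → (x ∧ y) ≈ (x ∧ z) → (x ∧ (y ∨ z)) ≈ (x ∧ y)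

  Semidistributive : Set (c ⊔ ℓ₁)
  Semidistributive = JoinSemidistributive × MeetSemidistributive

  IsAtom : Carrier → Set (c ⊔ ℓ₁ ⊔ ℓ₂)
  IsAtom a = (¬ (a ≈ ⊥)) × (∀ x → x ≤ a → (x ≈ ⊥) ⊎ (x ≈ a))

  ⋁ : List Carrier → Carrier
  ⋁ = foldr _∨_ ⊥

  IsAtomic : Set (c ⊔ ℓ₁ ⊔ ℓ₂)
  IsAtomic = ∀ x → Σ (List Carrier) λ as → All IsAtom as × (x ≈ ⋁ as)

  -- L is isomorphic (as a lattice, equivalently as a poset) to Bool(n) = (Subset n, ⊆)
  record IsoToBool (n : ℕ) : Set (c ⊔ ℓ₁ ⊔ ℓ₂) where
    field
      to      : Carrier → Subset n
      from    : Subset n → Carrier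
      to-cong : ∀ {x y} → x ≈ y → to x ≡ to y
      from-to : ∀ x → from (to x) ≈ x
      to-from : ∀ s → to (from s) ≡ s
      mono    : ∀ {x y} → x ≤ y → to x ⊆ to y
      reflect : ∀ {x y} → to x ⊆ to y → x ≤ y

-- In a meet-semidistributive lattice an atom a is join-prime: if a were disjoint
-- from every xᵢ, semidistributivity would make it disjoint from ⋁ xᵢ as well.
-- Hence the atoms below a join of atoms are exactly the atoms of the join, and in
-- an atomic lattice x ↦ {atoms below x} is an isomorphism onto the Boolean
-- lattice of sets of atoms (finite by finiteness of L). Conversely the
-- singletons are atoms of Bool(n) and every subset is their join.
module Submission where

open import Defs
open import Level using (Level; _⊔_)
open import Data.Nat using (ℕ)
open import Data.Product using (∃; ∃-syntax; _×_; _,_; proj₁; proj₂; uncurry)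
open import Function.Bundles using (_⇔_; mk⇔)
open import Relation.Binary.Lattice.Bundles using (BoundedLattice)

open import Function using (_∘_; case_of_)
open import Data.Sum using (_⊎_; inj₁; inj₂)
open import Data.Fin using (Fin; zero; suc)
open import Data.Fin.Subset using (Subset; _∈_; _⊆_; ⁅_⁆) renaming (⊥ to ∅)
open import Data.Fin.Subset.Properties
  using (_∈?_; ⊆-antisym; ⊆-reflexive; ⊆-trans; ⊥⊆; ∉⊥; x∈⁅x⁆; x∈⁅y⁆⇒x≡y)
open import Data.Vec using (tabulate)
open import Data.Vec.Properties using (lookup∘tabulate; []=⇒lookup; lookup⇒[]=)
open import Data.List using (List; []; _∷_; map; filter; allFin; concat; length; lookup; deduplicate)
import Data.List as List
open import Data.List.Membership.Propositional using (find; lose) renaming (_∈_ to _∈ₗ_)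
open import Data.List.Membership.Propositional.Properties
  using (∈-map⁺; ∈-map⁻; ∈-filter⁺; ∈-filter⁻; ∈-allFin; ∈-lookup)
open import Data.List.Membership.Setoid.Properties using (∈-deduplicate⁺)
open import Data.List.Relation.Unary.All as All using (All; []; _∷_)
open import Data.List.Relation.Unary.All.Properties
  using (¬Any⇒All¬; concat⁺; tabulate⁺; deduplicate⁺)
open import Data.List.Relation.Unary.Any as Any using (Any; here; there; any?)
open import Data.List.Relation.Unary.Any.Properties
  using (lookup-index) renaming (concat⁺ to Any-concat⁺; tabulate⁺ to Any-tabulate⁺)
open import Data.List.Relation.Unary.Unique.DecSetoid.Properties using (deduplicate-!)
import Data.List.Relation.Unary.Unique.Setoid as UniqueSetoid
open import Data.List.Relation.Unary.AllPairs using (_∷_)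
open import Relation.Binary.Bundles using (Setoid; DecSetoid)
open import Relation.Binary.Definitions using (Decidable)
open import Relation.Binary.Properties.Setoid using (respʳ-flip)
open import Relation.Nullary using (¬_; Dec; yes; no; does; contradiction)
open import Relation.Nullary.Decidable using (dec-true; _×-dec_)
import Relation.Nullary.Decidable as Dec
open import Relation.Unary using (Pred)
open import Relation.Binary.PropositionalEquality using (_≡_; refl; cong; subst; sym; trans)

module _ {a ℓ} (S : Setoid a ℓ) where
  open Setoid S using (_≈_) renaming (sym to ≈-sym)
  open UniqueSetoid S using (Unique)

  Unique⇒lookup-injective : ∀ {xs} → Unique xs → ∀ {i j} → lookup xs i ≈ lookup xs j → i ≡ j
  Unique⇒lookup-injective (_ ∷ _) {zero} {zero} _ = refl
  Unique⇒lookup-injective (x≉xs ∷ _) {zero} {suc j} x≈ = contradiction x≈ (All.lookup x≉xs (∈-lookup j))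
  Unique⇒lookup-injective (x≉xs ∷ _) {suc i} {zero} ≈x = contradiction (≈-sym ≈x) (All.lookup x≉xs (∈-lookup i))
  Unique⇒lookup-injective (_ ∷ u) {suc i} {suc j} eq = cong suc (Unique⇒lookup-injective u eq)

module _ {n p} {P : Pred (Fin n) p} (P? : Relation.Unary.Decidable P) where

  subsetOf : Subset n
  subsetOf = tabulate (does ∘ P?)

  ∈-subsetOf⁺ : ∀ {k} → P k → k ∈ subsetOf
  ∈-subsetOf⁺ {k} pk =
    lookup⇒[]= k subsetOf (trans (lookup∘tabulate (does ∘ P?) k) (dec-true (P? k) pk))

  ∈-subsetOf⁻ : ∀ {k} → k ∈ subsetOf → P k
  ∈-subsetOf⁻ {k} k∈ with P? k | trans (sym (lookup∘tabulate (does ∘ P?) k)) ([]=⇒lookup k∈)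
  ... | yes pk | _ = pk
  ... | no _ | ()

members : ∀ {n} → Subset n → List (Fin n)
members s = filter (_∈? s) (allFin _)

∈-members⁺ : ∀ {n} {s : Subset n} {k} → k ∈ s → k ∈ₗ members s
∈-members⁺ {k = k} = ∈-filter⁺ (_∈? _) (∈-allFin k)

∈-members⁻ : ∀ {n} {s : Subset n} {k} → k ∈ₗ members s → k ∈ s
∈-members⁻ {n} = proj₂ ∘ ∈-filter⁻ (_∈? _) {xs = allFin n}

module _ {c ℓ₁ ℓ₂ : Level} (L : BoundedLattice c ℓ₁ ℓ₂) where
  open BoundedLattice L hiding (refl) renaming (trans to ≤-trans)
  open import Relation.Binary.Lattice.Properties.BoundedLattice L using (∧-zeroʳ)
  open import Relation.Binary.Lattice.Properties.MeetSemilattice meetSemilattice using (y≤x⇒x∧y≈y; ∧-comm)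

  private variable
    a b x y : Carrier
    xs : List Carrier

  ≤⊥⇒≈⊥ : x ≤ ⊥ → x ≈ ⊥
  ≤⊥⇒≈⊥ x≤⊥ = antisym x≤⊥ (minimum _)

  ≤-⋁ : x ∈ₗ xs → x ≤ ⋁ L xs
  ≤-⋁ (here refl) = x≤x∨y _ _
  ≤-⋁ (there x∈) = ≤-trans (≤-⋁ x∈) (y≤x∨y _ _)

  ⋁-least : (∀ {x} → x ∈ₗ xs → x ≤ y) → ⋁ L xs ≤ y
  ⋁-least {[]} _ = minimum _
  ⋁-least {_ ∷ _} ub = ∨-least (ub (here refl)) (⋁-least (ub ∘ there))

  atom-≤⊎disjoint : IsAtom L a → ∀ x → a ≤ x ⊎ a ∧ x ≈ ⊥
  atom-≤⊎disjoint (_ , below-a) x with below-a (_ ∧ x) (x∧y≤x _ _)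
  ... | inj₁ a∧x≈⊥ = inj₂ a∧x≈⊥
  ... | inj₂ a∧x≈a = inj₁ (≤-trans (reflexive (Eq.sym a∧x≈a)) (x∧y≤y _ _))

  ≤⇒∧≈ : x ≤ y → x ∧ y ≈ x
  ≤⇒∧≈ {x} {y} x≤y = Eq.trans (∧-comm x y) (y≤x⇒x∧y≈y x≤y)

  disjoint⇒≰ : IsAtom L a → a ∧ x ≈ ⊥ → ¬ a ≤ x
  disjoint⇒≰ (a≉⊥ , _) a∧x≈⊥ a≤x = a≉⊥ (Eq.trans (Eq.sym (≤⇒∧≈ a≤x)) a∧x≈⊥)

  atom-≤? : IsAtom L a → ∀ x → Dec (a ≤ x)
  atom-≤? atom x with atom-≤⊎disjoint atom x
  ... | inj₁ a≤x = yes a≤x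
  ... | inj₂ a∧x≈⊥ = no (disjoint⇒≰ atom a∧x≈⊥)

  atom-≤-atom⇒≈ : IsAtom L a → IsAtom L b → a ≤ b → a ≈ b
  atom-≤-atom⇒≈ (a≉⊥ , _) (_ , below-b) a≤b with below-b _ a≤b
  ... | inj₁ a≈⊥ = contradiction a≈⊥ a≉⊥
  ... | inj₂ a≈b = a≈b

  module _ (msd : MeetSemidistributive L) where

    ∧-⋁-disjoint : All (λ x → b ∧ x ≈ ⊥) xs → b ∧ ⋁ L xs ≈ ⊥
    ∧-⋁-disjoint [] = ∧-zeroʳ _
    ∧-⋁-disjoint {b} {x ∷ xs} (b∧x≈⊥ ∷ disj) =
      Eq.trans (msd b x (⋁ L xs) (Eq.trans b∧x≈⊥ (Eq.sym (∧-⋁-disjoint disj)))) b∧x≈⊥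

    atom-≤-⋁ : IsAtom L a → a ≤ ⋁ L xs → ∃[ x ] x ∈ₗ xs × a ≤ x
    atom-≤-⋁ {a} {xs} atom a≤⋁ with any? (atom-≤? atom) xs
    ... | yes a≤some = find a≤some
    ... | no a≰all =
      contradiction a≤⋁ (disjoint⇒≰ atom (∧-⋁-disjoint (All.map disjoint (¬Any⇒All¬ xs a≰all))))
      where
      disjoint : ∀ {x} → ¬ a ≤ x → a ∧ x ≈ ⊥
      disjoint {x} a≰x with atom-≤⊎disjoint atom x
      ... | inj₁ a≤x = contradiction a≤x a≰x
      ... | inj₂ a∧x≈⊥ = a∧x≈⊥

  module _ (atomic : IsAtomic L) where

    atoms-below⇒≤ : (∀ {a} → IsAtom L a → a ≤ x → a ≤ y) → x ≤ y
    atoms-below⇒≤ {x} below with atomic x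
    ... | as , as-atoms , x≈⋁as = ≤-trans (reflexive x≈⋁as)
      (⋁-least λ a∈ → below (All.lookup as-atoms a∈) (≤-trans (≤-⋁ a∈) (reflexive (Eq.sym x≈⋁as))))

    ≤-dec : Decidable _≤_
    ≤-dec x y with atomic x
    ... | as , as-atoms , x≈⋁as = Dec.map′
      (λ as≤y → ≤-trans (reflexive x≈⋁as) (⋁-least (All.lookup as≤y)))
      (λ x≤y → All.tabulate λ a∈ → ≤-trans (≤-⋁ a∈) (≤-trans (reflexive (Eq.sym x≈⋁as)) x≤y))
      (atoms-≤? as-atoms)
      where
      atoms-≤? : ∀ {as} → All (IsAtom L) as → Dec (All (_≤ y) as)
      atoms-≤? [] = yes []
      atoms-≤? (atom ∷ atoms) =
        Dec.map′ (uncurry _∷_) (λ { (p ∷ ps) → p , ps }) (atom-≤? atom y ×-dec atoms-≤? atoms)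

    ≈-dec : Decidable _≈_
    ≈-dec x y = Dec.map′ (uncurry antisym) (λ x≈y → reflexive x≈y , reflexive (Eq.sym x≈y))
      (≤-dec x y ×-dec ≤-dec y x)

    decSetoid : DecSetoid c ℓ₁
    decSetoid = record { isDecEquivalence = record { isEquivalence = isEquivalence ; _≟_ = ≈-dec } }

  record AtomEnumeration (n : ℕ) : Set (c ⊔ ℓ₁ ⊔ ℓ₂) where
    field
      atom       : Fin n → Carrier
      isAtom     : ∀ k → IsAtom L (atom k)
      injective  : ∀ {i j} → atom i ≈ atom j → i ≡ j
      surjective : IsAtom L a → ∃[ k ] a ≈ atom k

  atomEnumeration : IsFinite L → IsAtomic L → MeetSemidistributive L → ∃ AtomEnumeration
  atomEnumeration (N , element , element-surjective) atomic msd = length atoms , record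
    { atom       = atom
    ; isAtom     = λ k → All.lookup atoms-atoms (∈-lookup k)
    ; injective  = Unique⇒lookup-injective setoid (deduplicate-! (decSetoid atomic) candidates)
    ; surjective = λ a-atom → Any.index (atoms-cover a-atom) , lookup-index (atoms-cover a-atom)
    }
    where
    decomposition : Fin N → List Carrier
    decomposition i = proj₁ (atomic (element i))

    decomposition-atoms : ∀ i → All (IsAtom L) (decomposition i)
    decomposition-atoms i = proj₁ (proj₂ (atomic (element i)))

    element≈⋁decomposition : ∀ i → element i ≈ ⋁ L (decomposition i)
    element≈⋁decomposition i = proj₂ (proj₂ (atomic (element i)))

    candidates : List Carrier
    candidates = concat (List.tabulate decomposition)

    candidates-cover : IsAtom L a → Any (a ≈_) candidates
    candidates-cover {a} a-atom =
      let i , element-i≈a = element-surjective a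
          a≤⋁ = reflexive (Eq.trans (Eq.sym element-i≈a) (element≈⋁decomposition i))
          x , x∈ , a≤x = atom-≤-⋁ msd a-atom a≤⋁
          a≈x = atom-≤-atom⇒≈ a-atom (All.lookup (decomposition-atoms i) x∈) a≤x
      in Any-concat⁺ (Any-tabulate⁺ i (lose x∈ a≈x))

    atoms : List Carrier
    atoms = deduplicate (≈-dec atomic) candidates

    atoms-atoms : All (IsAtom L) atoms
    atoms-atoms = deduplicate⁺ (≈-dec atomic) (concat⁺ (tabulate⁺ decomposition-atoms))

    atoms-cover : IsAtom L a → Any (a ≈_) atoms
    atoms-cover = ∈-deduplicate⁺ setoid (≈-dec atomic) (respʳ-flip setoid) ∘ candidates-cover

    atom : Fin (length atoms) → Carrier
    atom = lookup atoms

  module _ (atomic : IsAtomic L) (msd : MeetSemidistributive L) {n} (E : AtomEnumeration n) where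
    open AtomEnumeration E

    atomsBelow : Carrier → Subset n
    atomsBelow x = subsetOf (λ k → atom-≤? (isAtom k) x)

    ∈-atomsBelow⁺ : ∀ {k} → atom k ≤ x → k ∈ atomsBelow x
    ∈-atomsBelow⁺ {x} = ∈-subsetOf⁺ (λ k → atom-≤? (isAtom k) x)

    ∈-atomsBelow⁻ : ∀ {k} → k ∈ atomsBelow x → atom k ≤ x
    ∈-atomsBelow⁻ {x} = ∈-subsetOf⁻ (λ k → atom-≤? (isAtom k) x)

    joinOfAtoms : Subset n → Carrier
    joinOfAtoms s = ⋁ L (map atom (members s))

    atom-≤-joinOfAtoms : ∀ {k s} → k ∈ s → atom k ≤ joinOfAtoms s
    atom-≤-joinOfAtoms k∈s = ≤-⋁ (∈-map⁺ atom (∈-members⁺ k∈s))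

    atom-≤-joinOfAtoms⁻ : ∀ {k s} → atom k ≤ joinOfAtoms s → k ∈ s
    atom-≤-joinOfAtoms⁻ {k} atom-k≤ with atom-≤-⋁ msd (isAtom k) atom-k≤
    ... | x , x∈ , atom-k≤x with ∈-map⁻ atom x∈
    ...   | j , j∈ , refl =
      subst (_∈ _) (sym (injective (atom-≤-atom⇒≈ (isAtom k) (isAtom j) atom-k≤x))) (∈-members⁻ j∈)

    atomsBelow-mono : x ≤ y → atomsBelow x ⊆ atomsBelow y
    atomsBelow-mono x≤y k∈ = ∈-atomsBelow⁺ (≤-trans (∈-atomsBelow⁻ k∈) x≤y)

    atomsBelow-reflect : atomsBelow x ⊆ atomsBelow y → x ≤ y
    atomsBelow-reflect x⊆y = atoms-below⇒≤ atomic λ a-atom a≤x →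
      let k , a≈atom-k = surjective a-atom
          atom-k≤x = ≤-trans (reflexive (Eq.sym a≈atom-k)) a≤x
      in ≤-trans (reflexive a≈atom-k) (∈-atomsBelow⁻ (x⊆y (∈-atomsBelow⁺ atom-k≤x)))

    atomsBelow-joinOfAtoms : ∀ s → atomsBelow (joinOfAtoms s) ≡ s
    atomsBelow-joinOfAtoms s = ⊆-antisym
      (atom-≤-joinOfAtoms⁻ ∘ ∈-atomsBelow⁻)
      (∈-atomsBelow⁺ ∘ atom-≤-joinOfAtoms)

    isoToBool : IsoToBool L n
    isoToBool = record
      { to      = atomsBelow
      ; from    = joinOfAtoms
      ; to-cong = λ x≈y →
          ⊆-antisym (atomsBelow-mono (reflexive x≈y)) (atomsBelow-mono (reflexive (Eq.sym x≈y)))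
      ; from-to = λ x → antisym
          (atomsBelow-reflect (⊆-reflexive (atomsBelow-joinOfAtoms (atomsBelow x))))
          (atomsBelow-reflect (⊆-reflexive (sym (atomsBelow-joinOfAtoms (atomsBelow x)))))
      ; to-from = atomsBelow-joinOfAtoms
      ; mono    = atomsBelow-mono
      ; reflect = atomsBelow-reflect
      }

  module _ {n} (iso : IsoToBool L n) where
    open IsoToBool iso

    from-≤ : ∀ {s} → s ⊆ to y → from s ≤ y
    from-≤ {s = s} s⊆ = reflect (⊆-trans (⊆-reflexive (to-from s)) s⊆)

    ≤-from : ∀ {s} → to y ⊆ s → y ≤ from s
    ≤-from {s = s} ⊆s = reflect (⊆-trans ⊆s (⊆-reflexive (sym (to-from s))))

    ≤-from⇒⊆ : ∀ {s} → y ≤ from s → to y ⊆ s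
    ≤-from⇒⊆ {s = s} y≤ = ⊆-trans (mono y≤) (⊆-reflexive (to-from s))

    point : Fin n → Carrier
    point k = from ⁅ k ⁆

    point-≤⇒∈ : ∀ {k} → point k ≤ y → k ∈ to y
    point-≤⇒∈ {k = k} point≤y = mono point≤y (subst (k ∈_) (sym (to-from ⁅ k ⁆)) (x∈⁅x⁆ k))

    point-≤ : ∀ {k} → k ∈ to y → point k ≤ y
    point-≤ k∈ = from-≤ λ j∈ → subst (_∈ _) (sym (x∈⁅y⁆⇒x≡y _ j∈)) k∈

    point-isAtom : ∀ k → IsAtom L (point k)
    point-isAtom k = point≉⊥ , below-point
      where
      point≉⊥ : ¬ point k ≈ ⊥
      point≉⊥ point≈⊥ = ∉⊥ (≤-from⇒⊆ (minimum _) (point-≤⇒∈ (reflexive point≈⊥)))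

      below-point : ∀ y → y ≤ point k → y ≈ ⊥ ⊎ y ≈ point k
      below-point y y≤ with k ∈? to y
      ... | yes k∈ = inj₂ (antisym y≤ (point-≤ k∈))
      ... | no k∉ = inj₁ (≤⊥⇒≈⊥ (≤-trans (≤-from y⊆∅) (from-≤ ⊥⊆)))
        where
        y⊆∅ : to y ⊆ ∅
        y⊆∅ j∈ = contradiction (subst (_∈ to y) (x∈⁅y⁆⇒x≡y k (≤-from⇒⊆ y≤ j∈)) j∈) k∉

    isoToBool⇒atomic : IsAtomic L
    isoToBool⇒atomic x = points , All.tabulate point∈⇒atom , antisym
      (reflect λ k∈ → point-≤⇒∈ (≤-⋁ (∈-map⁺ point (∈-members⁺ k∈))))
      (⋁-least λ p∈ → case ∈-map⁻ point p∈ of λ { (k , k∈ , refl) → point-≤ (∈-members⁻ k∈) })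
      where
      points : List Carrier
      points = map point (members (to x))

      point∈⇒atom : ∀ {p} → p ∈ₗ points → IsAtom L p
      point∈⇒atom p∈ with ∈-map⁻ point p∈
      ... | k , _ , refl = point-isAtom k

theorem2p10 : {c ℓ₁ ℓ₂ : Level} (L : BoundedLattice c ℓ₁ ℓ₂) →
    IsFinite L → Semidistributive L →
    (IsAtomic L ⇔ ∃ λ (n : ℕ) → IsoToBool L n)
theorem2p10 L finite (_ , msd) = mk⇔
  (λ atomic → let n , E = atomEnumeration L finite atomic msd in n , isoToBool L atomic msd E)
  (λ (n , iso) → isoToBool⇒atomic L iso)
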